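{- Let $G$ be a finite undirected bipartite graph with no isolated vertices and no multiple edges, with bipartition $\mathcal{V}(G)=\mathcal{L}\cup\mathcal{R}$, and suppose $G$ is regular on one side, i.e., there is $d\in\mathbb{N}$ such that every vertex of $\mathcal{L}$ has degree $d$ (vertices of $\mathcal{R}$ may have arbitrary degrees). For a vertex $v$ let $d(v)$ denote its degree and let $\mathcal{E}(G)$ be the edge set. Then \[ |\mathcal{I}(G)| \le \prod_{r\in\mathcal{R}}\bigl(2^{d}+2^{d(r)}-1\bigr)^{1/d} = \prod_{(u,v)\in\mathcal{E}(G)}\bigl(2^{d(u)}+2^{d(v)}-1\bigr)^{\frac{1}{d(u)\,d(v)}}. \]
   Context: An independent set of $G$ is a subset of the vertex set containing no two adjacent vertices (the empty set is included); $\mathcal{I}(G)$ denotes the set of all independent sets of $G$, and $|\mathcal{I}(G)|$ its cardinality. -}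

module Defs where

open import Data.Bool using (Bool; true; false; _∧_; not; if_then_else_)
open import Data.Nat using (ℕ; zero; suc; _+_; _*_; _∸_; _^_)
open import Data.Fin using (Fin)
open import Data.Fin.Subset using (Subset; inside; outside)
open import Data.Vec using (Vec; []; _∷_; lookup)
open import Data.List using (List; []; _∷_; map; _++_; allFin; length; filter; cartesianProduct)
open import Data.Nat.ListAction using (sum; product)
open import Data.Bool.ListAction using (and)
open import Data.Product using (_×_; _,_)
open import Relation.Nullary.Decidable using (T?)

-- A finite simple bipartite graph with parts L = Fin m and R = Fin n,
-- given by its (bipartite) adjacency relation. Simplicity (no multiple
-- edges, no loops) is automatic in this representation.
BipGraph : ℕ → ℕ → Set
BipGraph m n = Fin m → Fin n → Bool

boolToℕ : Bool → ℕ
boolToℕ true = 1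
boolToℕ false = 0

module _ {m n : ℕ} (G : BipGraph m n) where

  degL : Fin m → ℕ
  degL l = sum (map (λ r → boolToℕ (G l r)) (allFin n))

  degR : Fin n → ℕ
  degR r = sum (map (λ l → boolToℕ (G l r)) (allFin m))

  -- A vertex subset is a pair (S , T) with S ⊆ L and T ⊆ R.
  -- It is independent iff no edge joins a vertex of S to a vertex of T
  -- (there are no edges inside L or inside R).
  isIndependent : Subset m × Subset n → Bool
  isIndependent (S , T) =
    and (map (λ l → and (map (λ r → not (lookup S l ∧ lookup T r ∧ G l r)) (allFin n))) (allFin m))

allSubsets : (k : ℕ) → List (Subset k)
allSubsets zero = [] ∷ []
allSubsets (suc k) = map (inside ∷_) (allSubsets k) ++ map (outside ∷_) (allSubsets k)

module _ {m n : ℕ} (G : BipGraph m n) where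

  numIndependentSets : ℕ
  numIndependentSets =
    length (filter (λ p → T? (isIndependent G p)) (cartesianProduct (allSubsets m) (allSubsets n)))

  -- 2^a + 2^b - 1 (always ≥ 1, so truncated subtraction is harmless)
  weight : ℕ → ℕ → ℕ
  weight a b = 2 ^ a + 2 ^ b ∸ 1

  rightProduct : ℕ → ℕ
  rightProduct d = product (map (λ r → weight d (degR G r)) (allFin n))

  edgeProduct : (Fin m → Fin n → ℕ) → ℕ
  edgeProduct e = product (map (λ l → product (map (λ r →
    if G l r then weight (degL G l) (degR G r) ^ e l r else 1) (allFin n))) (allFin m))

-- Write |I(G)| = Σ_{S ⊆ L} ∏_{r ∈ R} c(S ∩ N(r)), where c(y) = 2 if y = ∅ and 1 otherwise counts the
-- ways r can be added to an independent set containing S. Every l ∈ L lies in exactly d of the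
-- neighbourhoods N(r), so Finner's generalised Hölder inequality gives
-- |I(G)| ^ d ≤ ∏_r Σ_{y ⊆ N(r)} c(y) ^ d = ∏_r (2 ^ d + 2 ^ d(r) − 1).
-- Finner's inequality is proved by summing out one coordinate at a time with the two-term Hölder
-- inequality, itself a consequence of AM–GM. As ℕ has no e-th roots, each step uses ceiling roots of
-- values scaled by M, and the accumulated loss ((M + 1) / M) ^ (d² |L|) vanishes as M → ∞.
-- The second identity merely groups the edge product by right vertices: at r the exponents sum to 1 / d.

module Submission where

open import Defs
open import Data.Bool using (true)
open import Data.Nat using (ℕ; _*_; _^_; _≤_; _<_)
open import Data.Fin using (Fin)
open import Data.Product using (_×_; _,_)
open import Relation.Binary.PropositionalEquality using (_≡_)

open import Algebra.Bundles using (CommutativeMonoid)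
open import Data.Bool using (Bool; false; _∧_; _∨_; not; if_then_else_)
open import Data.Bool.ListAction using (and)
open import Data.Bool.Properties using (∧-zeroʳ; ∧-comm; ∧-commutativeMonoid)
open import Data.Fin using (zero; suc)
open import Data.Fin.Subset using (Subset; inside; outside; ⊤; _∩_; ∣_∣)
open import Data.List using (List; []; _∷_; map; _++_; length; tabulate; filter; cartesianProduct; allFin)
open import Data.List.Properties using (length-map; map-∘; map-cong; map-++; map-tabulate; tabulate-cong)
import Data.List.Relation.Unary.All as All
import Data.List.Relation.Unary.All.Properties as All
open import Data.Nat
open import Data.Nat.ListAction using (sum; product)
open import Data.Nat.ListAction.Properties using (sum-++; product≢0)
open import Data.Nat.Properties
open import Data.Nat.Tactic.RingSolver using (solve-∀)
open import Data.Product using (Σ; proj₁; proj₂)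
open import Data.Sum using (inj₁; inj₂)
import Data.Vec as Vec
open import Data.Vec using ([]; _∷_; lookup)
open import Data.Vec.Properties using (lookup∘tabulate)
open import Function using (_∘_)
open import Relation.Binary.PropositionalEquality
open import Relation.Nullary using (yes; no; contradiction)
open import Relation.Nullary.Decidable using (T?)

open import Algebra.Properties.CommutativeSemigroup +-commutativeSemigroup
  using () renaming (interchange to +-interchange; x∙yz≈y∙xz to x+[y+z]≡y+[x+z])
open import Algebra.Properties.CommutativeSemigroup *-commutativeSemigroup
  using () renaming ( interchange to *-interchange; x∙yz≈y∙xz to x*[y*z]≡y*[x*z]; x∙yz≈yx∙z to x*[y*z]≡[y*x]*z
                    ; x∙yz≈x∙zy to x*[y*z]≡x*[z*y]; x∙yz≈z∙xy to x*[y*z]≡z*[x*y]; xy∙z≈y∙xz to x*y*z≡y*[x*z]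
                    ; xy∙z≈xz∙y to x*y*z≡x*z*y )
open import Algebra.Properties.CommutativeSemigroup (CommutativeMonoid.commutativeSemigroup ∧-commutativeMonoid)
  using () renaming (interchange to ∧-interchange)

^-distribʳ-* : ∀ m n o → (m * n) ^ o ≡ m ^ o * n ^ o
^-distribʳ-* m n zero = refl
^-distribʳ-* m n (suc o) = begin
  m * n * (m * n) ^ o     ≡⟨ cong (m * n *_) (^-distribʳ-* m n o) ⟩
  m * n * (m ^ o * n ^ o) ≡⟨ *-interchange m n (m ^ o) (n ^ o) ⟩
  m * m ^ o * (n * n ^ o) ∎
  where
  open ≡-Reasoning

0^≡0 : ∀ e .{{_ : NonZero e}} → 0 ^ e ≡ 0
0^≡0 (suc e) = refl

^-cancelʳ-≤ : ∀ e .{{_ : NonZero e}} {x y} → x ^ e ≤ y ^ e → x ≤ y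
^-cancelʳ-≤ e {x} {y} xᵉ≤yᵉ with ≤-<-connex x y
... | inj₁ x≤y = x≤y
... | inj₂ y<x = contradiction xᵉ≤yᵉ (<⇒≱ (^-monoˡ-< e y<x))

2*[m*n]≤m*m+n*n : ∀ a b → 2 * (a * b) ≤ a * a + b * b
2*[m*n]≤m*m+n*n a b with ≤-total a b
... | inj₁ a≤b with t , refl ← m≤n⇒∃[o]m+o≡n a≤b = ≤-trans (m≤m+n _ (t * t)) (≤-reflexive (square a t))
  where
  square : ∀ a t → 2 * (a * (a + t)) + t * t ≡ a * a + (a + t) * (a + t)
  square = solve-∀
... | inj₂ b≤a with t , refl ← m≤n⇒∃[o]m+o≡n b≤a = ≤-trans (m≤m+n _ (t * t)) (≤-reflexive (square b t))
  where
  square : ∀ b t → 2 * ((b + t) * b) + t * t ≡ (b + t) * (b + t) + b * b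
  square = solve-∀

-- AM–GM for k copies of A ^ (k + 1) and one copy of B ^ (k + 1).
weighted-amgm : ∀ k A B → suc k * A ^ k * B ≤ B ^ suc k + k * A ^ suc k
weighted-amgm zero A B = ≤-reflexive (base A B)
  where
  base : ∀ A B → 1 * 1 * B ≡ B * 1 + 0 * (A * 1)
  base = solve-∀
weighted-amgm (suc k) A B = +-cancelʳ-≤ (k * (A * P * B)) _ _ (begin
  suc (suc k) * (A * P) * B + k * (A * P * B) ≡⟨ e₁ k A P B ⟩
  suc k * P * (2 * (A * B))                   ≤⟨ *-monoʳ-≤ (suc k * P) (2*[m*n]≤m*m+n*n A B) ⟩
  suc k * P * (A * A + B * B)                 ≡⟨ e₂ k A P B ⟩
  suc k * P * B * B + suc k * (A * (A * P))   ≤⟨ +-monoˡ-≤ _ (*-monoˡ-≤ B (weighted-amgm k A B)) ⟩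
  (Q + k * (A * P)) * B + suc k * (A * (A * P)) ≡⟨ e₃ k A P B Q ⟩
  B * Q + suc k * (A * (A * P)) + k * (A * P * B) ∎)
  where
  open ≤-Reasoning
  P = A ^ k
  Q = B ^ suc k
  e₁ : ∀ k A P B → suc (suc k) * (A * P) * B + k * (A * P * B) ≡ suc k * P * (2 * (A * B))
  e₁ = solve-∀
  e₂ : ∀ k A P B → suc k * P * (A * A + B * B) ≡ suc k * P * B * B + suc k * (A * (A * P))
  e₂ = solve-∀
  e₃ : ∀ k A P B Q → (Q + k * (A * P)) * B + suc k * (A * (A * P)) ≡ B * Q + suc k * (A * (A * P)) + k * (A * P * B)
  e₃ = solve-∀

-- The inductive step of AM–GM, i.e. weighted AM–GM at A = (n + 1) s and B = n (s + x).
amgm-step : ∀ n .{{_ : NonZero n}} s x → suc n ^ suc n * x * s ^ n ≤ n ^ n * (s + x) ^ suc n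
amgm-step n s x = *-cancelˡ-≤ n (+-cancelʳ-≤ (n * (suc n * s * (C * T))) _ _ (begin
  n * (suc n ^ suc n * x * s ^ n) + n * (suc n * s * (C * T)) ≡⟨ e₁ n s x C T ⟩
  suc n * (C * T) * B                ≡⟨ cong (λ z → suc n * z * B) (^-distribʳ-* (suc n) s n) ⟨
  suc n * A ^ n * B                  ≤⟨ weighted-amgm n A B ⟩
  B ^ suc n + n * A ^ suc n          ≡⟨ cong₂ (λ u v → u + n * (A * v)) (^-distribʳ-* n (s + x) (suc n)) (^-distribʳ-* (suc n) s n) ⟩
  n * n ^ n * V + n * (A * (C * T))  ≡⟨ cong (_+ n * (A * (C * T))) (*-assoc n (n ^ n) V) ⟩
  n * (n ^ n * V) + n * (suc n * s * (C * T)) ∎))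
  where
  open ≤-Reasoning
  C = suc n ^ n
  T = s ^ n
  V = (s + x) ^ suc n
  A = suc n * s
  B = n * (s + x)
  e₁ : ∀ n s x C T → n * (suc n * C * x * T) + n * (suc n * s * (C * T)) ≡ suc n * (C * T) * (n * (s + x))
  e₁ = solve-∀

amgm : ∀ ws → length ws ^ length ws * product ws ≤ sum ws ^ length ws
amgm [] = ≤-refl
amgm (x ∷ []) = ≤-reflexive (single x)
  where
  single : ∀ x → 1 * (x * 1) ≡ (x + 0) * 1
  single = solve-∀
amgm (x ∷ ws@(_ ∷ _)) = *-cancelˡ-≤ (n ^ n) {{m^n≢0 n n}} (begin
  n ^ n * (suc n ^ suc n * (x * product ws)) ≡⟨ shuffle (n ^ n) (suc n ^ suc n) x (product ws) ⟩
  suc n ^ suc n * x * (n ^ n * product ws)   ≤⟨ *-monoʳ-≤ (suc n ^ suc n * x) (amgm ws) ⟩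
  suc n ^ suc n * x * s ^ n                  ≤⟨ amgm-step n s x ⟩
  n ^ n * (s + x) ^ suc n                    ≡⟨ cong (λ z → n ^ n * z ^ suc n) (+-comm s x) ⟩
  n ^ n * (x + s) ^ suc n                    ∎)
  where
  open ≤-Reasoning
  n = length ws
  s = sum ws
  shuffle : ∀ a b c d → a * (b * (c * d)) ≡ b * c * (a * d)
  shuffle = solve-∀

product-map-*ˡ : ∀ c xs → product (map (c *_) xs) ≡ c ^ length xs * product xs
product-map-*ˡ c [] = refl
product-map-*ˡ c (x ∷ xs) = begin
  c * x * product (map (c *_) xs)     ≡⟨ cong (c * x *_) (product-map-*ˡ c xs) ⟩
  c * x * (c ^ length xs * product xs) ≡⟨ *-interchange c x (c ^ length xs) (product xs) ⟩
  c * c ^ length xs * (x * product xs) ∎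
  where
  open ≡-Reasoning

sum-map-*ˡ : ∀ c xs → sum (map (c *_) xs) ≡ c * sum xs
sum-map-*ˡ c [] = sym (*-zeroʳ c)
sum-map-*ˡ c (x ∷ xs) = trans (cong (c * x +_) (sum-map-*ˡ c xs)) (sym (*-distribˡ-+ c x (sum xs)))

module _ {A : Set} where

  product-map-^ : ∀ (f : A → ℕ) e xs → product (map f xs) ^ e ≡ product (map (λ x → f x ^ e) xs)
  product-map-^ f e [] = ^-zeroˡ e
  product-map-^ f e (x ∷ xs) = trans (^-distribʳ-* (f x) _ e) (cong (f x ^ e *_) (product-map-^ f e xs))

  product-map-1 : ∀ (xs : List A) → product (map (λ _ → 1) xs) ≡ 1
  product-map-1 [] = refl
  product-map-1 (x ∷ xs) = trans (+-identityʳ _) (product-map-1 xs)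

  product-map-* : ∀ (f g : A → ℕ) xs → product (map (λ x → f x * g x) xs) ≡ product (map f xs) * product (map g xs)
  product-map-* f g [] = refl
  product-map-* f g (x ∷ xs) =
    trans (cong (f x * g x *_) (product-map-* f g xs)) (*-interchange (f x) (g x) _ _)

  product-map-if-^ : ∀ (c : A → Bool) w (h : A → ℕ) xs
                   → product (map (λ x → if c x then w ^ h x else 1) xs) ≡ w ^ sum (map (λ x → if c x then h x else 0) xs)
  product-map-if-^ c w h [] = refl
  product-map-if-^ c w h (x ∷ xs) with c x
  ... | true = trans (cong (w ^ h x *_) (product-map-if-^ c w h xs)) (sym (^-distribˡ-+-* w (h x) _))
  ... | false = trans (+-identityʳ _) (product-map-if-^ c w h xs)

  sum-map-if-* : ∀ (c : A → Bool) (h : A → ℕ) a k xs → (∀ x → c x ≡ true → h x * k ≡ a)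
               → sum (map (λ x → if c x then h x else 0) xs) * k ≡ a * sum (map (boolToℕ ∘ c) xs)
  sum-map-if-* c h a k [] _ = sym (*-zeroʳ a)
  sum-map-if-* c h a k (x ∷ xs) hk≡a with c x in cx≡b
  ... | true = begin
    (h x + S) * k    ≡⟨ *-distribʳ-+ k (h x) S ⟩
    h x * k + S * k  ≡⟨ cong₂ _+_ (hk≡a x cx≡b) (sum-map-if-* c h a k xs hk≡a) ⟩
    a + a * C        ≡⟨ *-suc a C ⟨
    a * suc C        ∎
    where
    open ≡-Reasoning
    S = sum (map (λ x → if c x then h x else 0) xs)
    C = sum (map (boolToℕ ∘ c) xs)
  ... | false = sum-map-if-* c h a k xs hk≡a

product-swap : ∀ {A B : Set} (F : A → B → ℕ) xs ys
             → product (map (λ x → product (map (F x) ys)) xs) ≡ product (map (λ y → product (map (λ x → F x y) xs)) ys)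
product-swap F [] ys = sym (product-map-1 ys)
product-swap F (x ∷ xs) ys = trans (cong (product (map (F x) ys) *_) (product-swap F xs ys))
                                   (sym (product-map-* (F x) (λ y → product (map (λ x → F x y) xs)) ys))

length-filter-T? : ∀ {A : Set} (p : A → Bool) xs → length (filter (T? ∘ p) xs) ≡ sum (map (boolToℕ ∘ p) xs)
length-filter-T? p [] = refl
length-filter-T? p (x ∷ xs) with p x
... | true = cong suc (length-filter-T? p xs)
... | false = length-filter-T? p xs

sum-cartesianProduct : ∀ {A B : Set} (h : A × B → ℕ) xs ys
                     → sum (map h (cartesianProduct xs ys)) ≡ sum (map (λ x → sum (map (λ y → h (x , y)) ys)) xs)
sum-cartesianProduct h [] ys = refl
sum-cartesianProduct h (x ∷ xs) ys = begin
  sum (map h (map (x ,_) ys ++ cartesianProduct xs ys))               ≡⟨ cong sum (map-++ h (map (x ,_) ys) _) ⟩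
  sum (map h (map (x ,_) ys) ++ map h (cartesianProduct xs ys))       ≡⟨ sum-++ (map h (map (x ,_) ys)) _ ⟩
  sum (map h (map (x ,_) ys)) + sum (map h (cartesianProduct xs ys))  ≡⟨ cong₂ _+_ (cong sum (sym (map-∘ ys))) (sum-cartesianProduct h xs ys) ⟩
  sum (map (λ y → h (x , y)) ys) + sum (map (λ x → sum (map (λ y → h (x , y)) ys)) xs) ∎
  where open ≡-Reasoning

map-allFin : ∀ {n} {A : Set} (f : Fin n → A) → map f (allFin n) ≡ tabulate f
map-allFin f = map-tabulate (λ i → i) f

and-tabulate-true : ∀ {n} (f : Fin n → Bool) → (∀ i → f i ≡ true) → and (tabulate f) ≡ true
and-tabulate-true {zero} f _ = refl
and-tabulate-true {suc n} f fi≡true rewrite fi≡true zero = and-tabulate-true (f ∘ suc) (fi≡true ∘ suc)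

and-tabulate-∧ : ∀ {n} (f g : Fin n → Bool) → and (tabulate (λ i → f i ∧ g i)) ≡ and (tabulate f) ∧ and (tabulate g)
and-tabulate-∧ {zero} f g = refl
and-tabulate-∧ {suc n} f g = trans (cong ((f zero ∧ g zero) ∧_) (and-tabulate-∧ (f ∘ suc) (g ∘ suc)))
                                   (∧-interchange (f zero) (g zero) _ _)

and-tabulate-comm : ∀ {m n} (X : Fin m → Fin n → Bool)
                  → and (tabulate (λ i → and (tabulate (X i)))) ≡ and (tabulate (λ j → and (tabulate (λ i → X i j))))
and-tabulate-comm {zero} {n} X = sym (and-tabulate-true {n} (λ _ → true) (λ _ → refl))
and-tabulate-comm {suc m} X = trans (cong (and (tabulate (X zero)) ∧_) (and-tabulate-comm (X ∘ suc)))
                                    (sym (and-tabulate-∧ (X zero) _))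

and-tabulate-guard : ∀ {m} t (s g : Fin m → Bool)
                   → and (tabulate (λ l → not (s l ∧ t ∧ g l))) ≡ not t ∨ and (tabulate (λ l → not (s l ∧ g l)))
and-tabulate-guard true s g = refl
and-tabulate-guard false s g = and-tabulate-true _ (λ l → cong not (∧-zeroʳ (s l)))

-- Hölder's inequality

-- p ^ e * Q ≤ U ^ e * R encodes p · (Q / R) ^ (1 / e) ≤ U, which is additive in (p , U).
RootBound : ℕ → ℕ → ℕ → ℕ → ℕ → Set
RootBound e Q R p U = p ^ e * Q ≤ U ^ e * R

private
  rootBound-+-ordered : ∀ e Q R p q U V → RootBound e Q R p U → RootBound e Q R q V → V * p ≤ U * q
                      → RootBound e Q R (p + q) (U + V)
  rootBound-+-ordered e Q R p zero U V pU _ _ = begin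
    (p + 0) ^ e * Q ≡⟨ cong (λ z → z ^ e * Q) (+-identityʳ p) ⟩
    p ^ e * Q       ≤⟨ pU ⟩
    U ^ e * R       ≤⟨ *-monoˡ-≤ R (^-monoˡ-≤ e (m≤m+n U V)) ⟩
    (U + V) ^ e * R ∎
    where open ≤-Reasoning
  rootBound-+-ordered e Q R p q@(suc _) U V _ qV Vp≤Uq = *-cancelˡ-≤ (q ^ e) {{m^n≢0 q e}} (begin
    q ^ e * ((p + q) ^ e * Q)      ≡⟨ x*[y*z]≡y*[x*z] (q ^ e) ((p + q) ^ e) Q ⟩
    (p + q) ^ e * (q ^ e * Q)      ≤⟨ *-monoʳ-≤ ((p + q) ^ e) qV ⟩
    (p + q) ^ e * (V ^ e * R)      ≡⟨ *-assoc ((p + q) ^ e) _ R ⟨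
    (p + q) ^ e * V ^ e * R        ≡⟨ cong (_* R) (^-distribʳ-* (p + q) V e) ⟨
    ((p + q) * V) ^ e * R          ≤⟨ *-monoˡ-≤ R (^-monoˡ-≤ e cross) ⟩
    ((U + V) * q) ^ e * R          ≡⟨ cong (_* R) (^-distribʳ-* (U + V) q e) ⟩
    (U + V) ^ e * q ^ e * R        ≡⟨ x*y*z≡y*[x*z] ((U + V) ^ e) (q ^ e) R ⟩
    q ^ e * ((U + V) ^ e * R)      ∎)
    where
    open ≤-Reasoning
    cross : (p + q) * V ≤ (U + V) * q
    cross = begin
      (p + q) * V   ≡⟨ *-distribʳ-+ V p q ⟩
      p * V + q * V ≡⟨ cong₂ _+_ (*-comm p V) (*-comm q V) ⟩
      V * p + V * q ≤⟨ +-monoˡ-≤ (V * q) Vp≤Uq ⟩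
      U * q + V * q ≡⟨ *-distribʳ-+ q U V ⟨
      (U + V) * q   ∎

rootBound-+ : ∀ e Q R p q U V → RootBound e Q R p U → RootBound e Q R q V → RootBound e Q R (p + q) (U + V)
rootBound-+ e Q R p q U V pU qV with ≤-total (V * p) (U * q)
... | inj₁ Vp≤Uq = rootBound-+-ordered e Q R p q U V pU qV Vp≤Uq
... | inj₂ Uq≤Vp = subst₂ (RootBound e Q R) (+-comm q p) (+-comm V U)
                     (rootBound-+-ordered e Q R q p V U qV pU Uq≤Vp)

module TwoTermHolder (e : ℕ) where

  powerSum : ℕ × ℕ → ℕ
  powerSum (a , b) = a ^ e + b ^ e

  powerSumProduct : List (ℕ × ℕ) → ℕ
  powerSumProduct ps = product (map powerSum ps)

  -- The i-th weight is f pᵢ ^ e · ∏_{j ≠ i} powerSum pⱼ.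
  weights : (ℕ × ℕ → ℕ) → List (ℕ × ℕ) → List ℕ
  weights f [] = []
  weights f (p ∷ ps) = f p ^ e * powerSumProduct ps ∷ map (powerSum p *_) (weights f ps)

  length-weights : ∀ f ps → length (weights f ps) ≡ length ps
  length-weights f [] = refl
  length-weights f (p ∷ ps) = cong suc (trans (length-map _ (weights f ps)) (length-weights f ps))

  product-weights : ∀ f ps → product (weights f ps) * powerSumProduct ps
                            ≡ product (map f ps) ^ e * powerSumProduct ps ^ length ps
  product-weights f [] = cong (_* 1) (sym (^-zeroˡ e))
  product-weights f (p ∷ ps) = begin
    x * C * product (map (c *_) (weights f ps)) * (c * C)  ≡⟨ cong (λ z → x * C * z * (c * C)) (product-map-*ˡ c (weights f ps)) ⟩
    x * C * (c ^ length (weights f ps) * W) * (c * C)      ≡⟨ cong (λ z → x * C * (c ^ z * W) * (c * C)) (length-weights f ps) ⟩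
    x * C * (c ^ n * W) * (c * C)                          ≡⟨ regroup x C (c ^ n) W c ⟩
    x * (c * c ^ n) * C * (W * C)                          ≡⟨ cong (x * (c * c ^ n) * C *_) (product-weights f ps) ⟩
    x * (c * c ^ n) * C * (F ^ e * C ^ n)                  ≡⟨ regroup′ x (c * c ^ n) C (F ^ e) (C ^ n) ⟩
    x * F ^ e * ((c * c ^ n) * (C * C ^ n))                ≡⟨ cong₂ _*_ (^-distribʳ-* (f p) F e) (^-distribʳ-* c C (suc n)) ⟨
    (f p * F) ^ e * (c * C) ^ suc n                        ∎
    where
    open ≡-Reasoning
    x = f p ^ e
    c = powerSum p
    C = powerSumProduct ps
    W = product (weights f ps)
    F = product (map f ps)
    n = length ps
    regroup : ∀ x C y W c → x * C * (y * W) * (c * C) ≡ x * (c * y) * C * (W * C)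
    regroup = solve-∀
    regroup′ : ∀ x y C u v → x * y * C * (u * v) ≡ x * u * (y * (C * v))
    regroup′ = solve-∀

  sum-weights : ∀ ps → sum (weights proj₁ ps) + sum (weights proj₂ ps) ≡ length ps * powerSumProduct ps
  sum-weights [] = refl
  sum-weights ((a , b) ∷ ps) = begin
    a ^ e * C + sum (map (c *_) U) + (b ^ e * C + sum (map (c *_) V))
      ≡⟨ cong₂ (λ u v → a ^ e * C + u + (b ^ e * C + v)) (sum-map-*ˡ c U) (sum-map-*ˡ c V) ⟩
    a ^ e * C + c * sum U + (b ^ e * C + c * sum V)
      ≡⟨ factor (a ^ e) (b ^ e) C (sum U) (sum V) ⟩
    c * C + c * (sum U + sum V)
      ≡⟨ cong (λ z → c * C + c * z) (sum-weights ps) ⟩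
    c * C + c * (length ps * C)
      ≡⟨ factor′ c C (length ps) ⟩
    suc (length ps) * (c * C) ∎
    where
    open ≡-Reasoning
    C = powerSumProduct ps
    c = powerSum (a , b)
    U = weights proj₁ ps
    V = weights proj₂ ps
    factor : ∀ x y C u v → x * C + (x + y) * u + (y * C + (x + y) * v) ≡ (x + y) * C + (x + y) * (u + v)
    factor = solve-∀
    factor′ : ∀ c C n → c * C + c * (n * C) ≡ suc n * (c * C)
    factor′ = solve-∀

  module _ .{{_ : NonZero e}} where

    powerSumProduct≡0 : ∀ ps → powerSumProduct ps ≡ 0
                      → product (map proj₁ ps) ≡ 0 × product (map proj₂ ps) ≡ 0
    powerSumProduct≡0 ((a , b) ∷ ps) eq with m*n≡0⇒m≡0∨n≡0 (a ^ e + b ^ e) eq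
    ... | inj₁ sum≡0 = cong (_* _) (m^n≡0⇒m≡0 a e (m+n≡0⇒m≡0 _ sum≡0))
                     , cong (_* _) (m^n≡0⇒m≡0 b e (m+n≡0⇒n≡0 (a ^ e) sum≡0))
    ... | inj₂ rest≡0 with pa , pb ← powerSumProduct≡0 ps rest≡0 =
      trans (cong (a *_) pa) (*-zeroʳ a) , trans (cong (b *_) pb) (*-zeroʳ b)

    weights-amgm : ∀ f ps → length ps ≡ e
                 → RootBound e (powerSumProduct ps ^ e) (powerSumProduct ps) (e * product (map f ps)) (sum (weights f ps))
    weights-amgm f ps refl = begin
      (e * F) ^ e * C ^ e           ≡⟨ cong (_* C ^ e) (^-distribʳ-* e F e) ⟩
      e ^ e * F ^ e * C ^ e         ≡⟨ *-assoc (e ^ e) _ _ ⟩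
      e ^ e * (F ^ e * C ^ e)       ≡⟨ cong (e ^ e *_) (product-weights f ps) ⟨
      e ^ e * (W * C)               ≡⟨ *-assoc (e ^ e) W C ⟨
      e ^ e * W * C                 ≡⟨ cong (λ z → z ^ z * W * C) (length-weights f ps) ⟨
      length ws ^ length ws * W * C ≤⟨ *-monoˡ-≤ C (amgm ws) ⟩
      sum ws ^ length ws * C        ≡⟨ cong (λ z → sum ws ^ z * C) (length-weights f ps) ⟩
      sum ws ^ e * C                ∎
      where
      open ≤-Reasoning
      ws = weights f ps
      W = product ws
      F = product (map f ps)
      C = powerSumProduct ps

    -- AM–GM on the weights gives e · ∏ aᵢ · C ^ ((e − 1) / e) ≤ Σ weights proj₁, likewise for the bᵢ,
    -- and the two weight sums add up to e · C, where C = powerSumProduct ps.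
    holder : ∀ ps → length ps ≡ e → (product (map proj₁ ps) + product (map proj₂ ps)) ^ e ≤ powerSumProduct ps
    holder ps len with powerSumProduct ps in C≡
    ... | zero with pa , pb ← powerSumProduct≡0 ps C≡ rewrite pa | pb = ≤-reflexive (0^≡0 e)
    ... | C@(suc _) = *-cancelˡ-≤ (e ^ e * C ^ e) {{m*n≢0 (e ^ e) (C ^ e) {{m^n≢0 e e}} {{m^n≢0 C e}}}} (begin
      e ^ e * C ^ e * (A + B) ^ e        ≡⟨ x*y*z≡x*z*y (e ^ e) (C ^ e) ((A + B) ^ e) ⟩
      e ^ e * (A + B) ^ e * C ^ e        ≡⟨ cong (_* C ^ e) (^-distribʳ-* e (A + B) e) ⟨
      (e * (A + B)) ^ e * C ^ e          ≡⟨ cong (λ z → z ^ e * C ^ e) (*-distribˡ-+ e A B) ⟩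
      (e * A + e * B) ^ e * C ^ e        ≤⟨ rootBound-+ e (C ^ e) C (e * A) (e * B) _ _ (bound proj₁) (bound proj₂) ⟩
      (sum (weights proj₁ ps) + sum (weights proj₂ ps)) ^ e * C
        ≡⟨ cong (λ z → z ^ e * C) (trans (sum-weights ps) (cong₂ _*_ len C≡)) ⟩
      (e * C) ^ e * C                    ≡⟨ cong (_* C) (^-distribʳ-* e C e) ⟩
      e ^ e * C ^ e * C                  ∎)
      where
      open ≤-Reasoning
      A = product (map proj₁ ps)
      B = product (map proj₂ ps)
      bound : ∀ f → RootBound e (C ^ e) C (e * product (map f ps)) (sum (weights f ps))
      bound f = subst (λ z → RootBound e (z ^ e) z (e * product (map f ps)) (sum (weights f ps))) C≡ (weights-amgm f ps len)

module ScaledHolder (e : ℕ) .{{_ : NonZero e}} (M : ℕ) where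
  open TwoTermHolder e

  -- An active column carries h ≥ M · (u ^ e + v ^ e) ^ (1 / e); a passive one has u = v = h.
  data Column : Set where
    active  : (u v h : ℕ) → M ^ e * (u ^ e + v ^ e) ≤ h ^ e → Column
    passive : ℕ → Column

  ends : Column → ℕ × ℕ
  ends (active u v _ _) = u , v
  ends (passive c) = c , c

  merged : Column → ℕ
  merged (active _ _ h _) = h
  merged (passive c) = c

  activeCount : List Column → ℕ
  activeCount [] = 0
  activeCount (active _ _ _ _ ∷ cs) = suc (activeCount cs)
  activeCount (passive _ ∷ cs) = activeCount cs

  activePairs : List Column → List (ℕ × ℕ)
  activePairs [] = []
  activePairs (active u v _ _ ∷ cs) = (u , v) ∷ activePairs cs
  activePairs (passive _ ∷ cs) = activePairs cs

  activeMerged passiveProduct : List Column → ℕ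
  activeMerged [] = 1
  activeMerged (active _ _ h _ ∷ cs) = h * activeMerged cs
  activeMerged (passive _ ∷ cs) = activeMerged cs
  passiveProduct [] = 1
  passiveProduct (active _ _ _ _ ∷ cs) = passiveProduct cs
  passiveProduct (passive c ∷ cs) = c * passiveProduct cs

  length-activePairs : ∀ cs → length (activePairs cs) ≡ activeCount cs
  length-activePairs [] = refl
  length-activePairs (active _ _ _ _ ∷ cs) = cong suc (length-activePairs cs)
  length-activePairs (passive _ ∷ cs) = length-activePairs cs

  product-ends : ∀ (f : ℕ × ℕ → ℕ) → (∀ c → f (c , c) ≡ c) → ∀ cs
               → product (map (f ∘ ends) cs) ≡ passiveProduct cs * product (map f (activePairs cs))
  product-ends f diag [] = refl
  product-ends f diag (active u v _ _ ∷ cs) =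
    trans (cong (f (u , v) *_) (product-ends f diag cs)) (x*[y*z]≡y*[x*z] (f (u , v)) (passiveProduct cs) _)
  product-ends f diag (passive c ∷ cs) =
    trans (cong₂ _*_ (diag c) (product-ends f diag cs)) (sym (*-assoc c _ _))

  product-merged : ∀ cs → product (map merged cs) ≡ passiveProduct cs * activeMerged cs
  product-merged [] = refl
  product-merged (active _ _ h _ ∷ cs) = trans (cong (h *_) (product-merged cs)) (x*[y*z]≡y*[x*z] h (passiveProduct cs) _)
  product-merged (passive c ∷ cs) = trans (cong (c *_) (product-merged cs)) (sym (*-assoc c _ _))

  activeMerged-bound : ∀ cs → (M ^ e) ^ activeCount cs * powerSumProduct (activePairs cs) ≤ activeMerged cs ^ e
  activeMerged-bound [] = ≤-reflexive (sym (^-zeroˡ e))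
  activeMerged-bound (active u v h Mh≤hᵉ ∷ cs) = begin
    M ^ e * (M ^ e) ^ activeCount cs * ((u ^ e + v ^ e) * P) ≡⟨ *-interchange (M ^ e) _ (u ^ e + v ^ e) P ⟩
    M ^ e * (u ^ e + v ^ e) * ((M ^ e) ^ activeCount cs * P) ≤⟨ *-mono-≤ Mh≤hᵉ (activeMerged-bound cs) ⟩
    h ^ e * activeMerged cs ^ e                               ≡⟨ ^-distribʳ-* h (activeMerged cs) e ⟨
    (h * activeMerged cs) ^ e                                 ∎
    where
    open ≤-Reasoning
    P = powerSumProduct (activePairs cs)
  activeMerged-bound (passive _ ∷ cs) = activeMerged-bound cs

  scaledHolder : ∀ cs → activeCount cs ≡ e
               → M ^ e * (product (map (proj₁ ∘ ends) cs) + product (map (proj₂ ∘ ends) cs)) ≤ product (map merged cs)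
  scaledHolder cs count≡e = begin
    M ^ e * (product (map (proj₁ ∘ ends) cs) + product (map (proj₂ ∘ ends) cs))
      ≡⟨ cong₂ (λ a b → M ^ e * (a + b)) (product-ends proj₁ (λ _ → refl) cs) (product-ends proj₂ (λ _ → refl) cs) ⟩
    M ^ e * (K * A + K * B)  ≡⟨ cong (M ^ e *_) (*-distribˡ-+ K A B) ⟨
    M ^ e * (K * (A + B))    ≡⟨ x*[y*z]≡y*[x*z] (M ^ e) K (A + B) ⟩
    K * (M ^ e * (A + B))    ≤⟨ *-monoʳ-≤ K (^-cancelʳ-≤ e activeBound) ⟩
    K * activeMerged cs      ≡⟨ product-merged cs ⟨
    product (map merged cs)  ∎
    where
    open ≤-Reasoning
    ps = activePairs cs
    K = passiveProduct cs
    A = product (map proj₁ ps)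
    B = product (map proj₂ ps)
    activeBound : (M ^ e * (A + B)) ^ e ≤ activeMerged cs ^ e
    activeBound = begin
      (M ^ e * (A + B)) ^ e                          ≡⟨ ^-distribʳ-* (M ^ e) (A + B) e ⟩
      (M ^ e) ^ e * (A + B) ^ e                      ≤⟨ *-monoʳ-≤ ((M ^ e) ^ e) (holder ps (trans (length-activePairs cs) count≡e)) ⟩
      (M ^ e) ^ e * powerSumProduct ps               ≡⟨ cong (λ k → (M ^ e) ^ k * powerSumProduct ps) count≡e ⟨
      (M ^ e) ^ activeCount cs * powerSumProduct ps  ≤⟨ activeMerged-bound cs ⟩
      activeMerged cs ^ e                            ∎

-- Integer roots and a limiting argument

module CeilingRoot (e : ℕ) .{{_ : NonZero e}} where

  IsCeilingRoot : ℕ → ℕ → Set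
  IsCeilingRoot N H = N ≤ H ^ e × (∀ H′ → H′ < H → H′ ^ e < N)

  private
    search : ∀ N fuel H → (∀ H′ → H′ < H → H′ ^ e < N) → N ≤ (H + fuel) ^ e → Σ ℕ (IsCeilingRoot N)
    search N fuel H below N≤ with N ≤? H ^ e
    ... | yes N≤Hᵉ = H , N≤Hᵉ , below
    search N zero H below N≤ | no N≰Hᵉ = contradiction (subst (λ z → N ≤ z ^ e) (+-identityʳ H) N≤) N≰Hᵉ
    search N (suc fuel) H below N≤ | no N≰Hᵉ = search N fuel (suc H) below′ (subst (λ z → N ≤ z ^ e) (+-suc H fuel) N≤)
      where
      below′ : ∀ H′ → H′ < suc H → H′ ^ e < N
      below′ H′ H′<1+H with m<1+n⇒m<n∨m≡n H′<1+H
      ... | inj₁ H′<H = below H′ H′<H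
      ... | inj₂ refl = ≰⇒> N≰Hᵉ

    n≤n^e : ∀ n → n ≤ n ^ e
    n≤n^e zero = z≤n
    n≤n^e (suc n) = subst (_≤ suc n ^ e) (^-identityʳ (suc n)) (^-monoʳ-≤ (suc n) (>-nonZero⁻¹ e))

  ceilingRoot : ∀ N → Σ ℕ (IsCeilingRoot N)
  ceilingRoot N = search N N 0 (λ _ ()) (n≤n^e N)

  -- ⌈M · Φ^(1/e)⌉ ≤ (M + 1) · Φ^(1/e) because Φ^(1/e) ≥ 1 whenever the root is positive.
  ceilingRoot-scaled : ∀ M Φ H → IsCeilingRoot (M ^ e * Φ) H → H ^ e ≤ suc M ^ e * Φ
  ceilingRoot-scaled M Φ zero _ = subst (_≤ suc M ^ e * Φ) (sym (0^≡0 e)) z≤n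
  ceilingRoot-scaled M Φ (suc a) (_ , below) with below a ≤-refl | M ≤? a
  ... | aᵉ<MᵉΦ | yes M≤a = *-cancelˡ-≤ (M ^ e) {{Mᵉ≢0}} (begin
    M ^ e * suc a ^ e        ≡⟨ ^-distribʳ-* M (suc a) e ⟨
    (M * suc a) ^ e          ≤⟨ ^-monoˡ-≤ e M[a+1]≤[M+1]a ⟩
    (suc M * a) ^ e          ≡⟨ ^-distribʳ-* (suc M) a e ⟩
    suc M ^ e * a ^ e        ≤⟨ *-monoʳ-≤ (suc M ^ e) (<⇒≤ aᵉ<MᵉΦ) ⟩
    suc M ^ e * (M ^ e * Φ)  ≡⟨ x*[y*z]≡y*[x*z] (suc M ^ e) (M ^ e) Φ ⟩
    M ^ e * (suc M ^ e * Φ)  ∎)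
    where
    open ≤-Reasoning
    M[a+1]≤[M+1]a : M * suc a ≤ suc M * a
    M[a+1]≤[M+1]a = begin
      M * suc a ≡⟨ *-suc M a ⟩
      M + M * a ≤⟨ +-monoˡ-≤ (M * a) M≤a ⟩
      a + M * a ∎
    Mᵉ≢0 : NonZero (M ^ e)
    Mᵉ≢0 = m*n≢0⇒m≢0 (M ^ e) {{>-nonZero (≤-<-trans z≤n aᵉ<MᵉΦ)}}
  ... | aᵉ<MᵉΦ | no M≰a = begin
    suc a ^ e       ≤⟨ ^-monoˡ-≤ e (m≤n⇒m≤1+n (≰⇒> M≰a)) ⟩
    suc M ^ e       ≡⟨ *-identityʳ _ ⟨
    suc M ^ e * 1   ≤⟨ *-monoʳ-≤ (suc M ^ e) (n≢0⇒n>0 Φ≢0) ⟩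
    suc M ^ e * Φ   ∎
    where
    open ≤-Reasoning
    Φ≢0 : Φ ≢ 0
    Φ≢0 refl = n≮0 (subst (a ^ e <_) (*-zeroʳ (M ^ e)) aᵉ<MᵉΦ)

^-growth : ∀ K t → suc (K + t) ^ K * t ≤ (K + t) ^ suc K
^-growth zero t = ≤-reflexive (trans (+-identityʳ t) (sym (*-identityʳ t)))
^-growth (suc K) t = begin
  suc n ^ suc K * t                ≡⟨ x*y*z≡y*[x*z] (suc n) (suc n ^ K) t ⟩
  suc n ^ K * (suc n * t)          ≤⟨ *-monoʳ-≤ (suc n ^ K) [n+1]t≤n[t+1] ⟩
  suc n ^ K * (n * suc t)          ≡⟨ x*[y*z]≡y*[x*z] (suc n ^ K) n (suc t) ⟩
  n * (suc n ^ K * suc t)          ≡⟨ cong (λ z → n * (suc z ^ K * suc t)) n≡K+[t+1] ⟩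
  n * (suc (K + suc t) ^ K * suc t) ≤⟨ *-monoʳ-≤ n (^-growth K (suc t)) ⟩
  n * (K + suc t) ^ suc K          ≡⟨ cong (λ z → n * z ^ suc K) n≡K+[t+1] ⟨
  n * n ^ suc K                    ∎
  where
  open ≤-Reasoning
  n = suc K + t
  n≡K+[t+1] : n ≡ K + suc t
  n≡K+[t+1] = sym (+-suc K t)
  [n+1]t≤n[t+1] : suc n * t ≤ n * suc t
  [n+1]t≤n[t+1] = begin
    t + n * t ≤⟨ +-monoˡ-≤ (n * t) (m≤n+m t (suc K)) ⟩
    n + n * t ≡⟨ *-suc n t ⟨
    n * suc t ∎

-- Letting M → ∞: were A ≥ B + 1, the choice t = B K + 1, M = K + t contradicts ^-growth.
≤-by-scaling : ∀ A B K → (∀ M → A * M ^ K ≤ B * suc M ^ K) → A ≤ B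
≤-by-scaling A B K scaled with A ≤? B
... | yes A≤B = A≤B
... | no A≰B = contradiction (*-cancelˡ-≤ (M ^ K) {{m^n≢0 M K {{M≢0}}}} bound) (<⇒≱ (≤-reflexive (sym [B+1]t≡1+BM)))
  where
  open ≤-Reasoning
  t = B * K + 1
  M = K + t
  M≢0 : NonZero M
  M≢0 = ≢-nonZero (λ M≡0 → 1+n≢0 (trans (+-comm 1 (B * K)) (m+n≡0⇒n≡0 K M≡0)))
  bound : M ^ K * (suc B * t) ≤ M ^ K * (B * M)
  bound = begin
    M ^ K * (suc B * t) ≡⟨ x*[y*z]≡[y*x]*z (M ^ K) (suc B) t ⟩
    suc B * M ^ K * t   ≤⟨ *-monoˡ-≤ t (*-monoˡ-≤ (M ^ K) (≰⇒> A≰B)) ⟩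
    A * M ^ K * t       ≤⟨ *-monoˡ-≤ t (scaled M) ⟩
    B * suc M ^ K * t   ≡⟨ *-assoc B _ t ⟩
    B * (suc M ^ K * t) ≤⟨ *-monoʳ-≤ B (^-growth K t) ⟩
    B * M ^ suc K       ≡⟨ x*[y*z]≡z*[x*y] B M (M ^ K) ⟩
    M ^ K * (B * M)     ∎
  [B+1]t≡1+BM : suc B * t ≡ suc (B * M)
  [B+1]t≡1+BM = expand B K
    where
    expand : ∀ B K → (1 + B) * (B * K + 1) ≡ 1 + B * (K + (B * K + 1))
    expand = solve-∀

sumOver : ∀ {m} → Subset m → (Subset m → ℕ) → ℕ
sumOver [] f = f []
sumOver (inside ∷ A) f = sumOver A (f ∘ (inside ∷_)) + sumOver A (f ∘ (outside ∷_))
sumOver (outside ∷ A) f = sumOver A (f ∘ (outside ∷_))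

sumOver-+ : ∀ {m} (A : Subset m) f g → sumOver A (λ x → f x + g x) ≡ sumOver A f + sumOver A g
sumOver-+ [] f g = refl
sumOver-+ (inside ∷ A) f g = begin
  sumOver A (λ x → f (inside ∷ x) + g (inside ∷ x)) + sumOver A (λ x → f (outside ∷ x) + g (outside ∷ x))
    ≡⟨ cong₂ _+_ (sumOver-+ A _ _) (sumOver-+ A _ _) ⟩
  (sumOver A (f ∘ (inside ∷_)) + sumOver A (g ∘ (inside ∷_))) + (sumOver A (f ∘ (outside ∷_)) + sumOver A (g ∘ (outside ∷_)))
    ≡⟨ +-interchange (sumOver A (f ∘ (inside ∷_))) _ _ _ ⟩
  sumOver (inside ∷ A) f + sumOver (inside ∷ A) g ∎
  where open ≡-Reasoning
sumOver-+ (outside ∷ A) f g = sumOver-+ A _ _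

sumOver-*ˡ : ∀ {m} (A : Subset m) c f → sumOver A (λ x → c * f x) ≡ c * sumOver A f
sumOver-*ˡ [] c f = refl
sumOver-*ˡ (inside ∷ A) c f =
  trans (cong₂ _+_ (sumOver-*ˡ A c _) (sumOver-*ˡ A c _)) (sym (*-distribˡ-+ c _ _))
sumOver-*ˡ (outside ∷ A) c f = sumOver-*ˡ A c _

sumOver-mono-≤ : ∀ {m} (A : Subset m) {f g} → (∀ x → f x ≤ g x) → sumOver A f ≤ sumOver A g
sumOver-mono-≤ [] f≤g = f≤g []
sumOver-mono-≤ (inside ∷ A) f≤g = +-mono-≤ (sumOver-mono-≤ A (f≤g ∘ (inside ∷_))) (sumOver-mono-≤ A (f≤g ∘ (outside ∷_)))
sumOver-mono-≤ (outside ∷ A) f≤g = sumOver-mono-≤ A (f≤g ∘ (outside ∷_))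

sumOver-cong : ∀ {m} (A : Subset m) {f g} → (∀ x → f x ≡ g x) → sumOver A f ≡ sumOver A g
sumOver-cong A f≗g = ≤-antisym (sumOver-mono-≤ A (≤-reflexive ∘ f≗g)) (sumOver-mono-≤ A (≤-reflexive ∘ sym ∘ f≗g))

*-2^-double : ∀ c k → c * 2 ^ k + c * 2 ^ k ≡ c * 2 ^ suc k
*-2^-double c k = trans (sym (*-distribˡ-+ c _ _)) (cong (λ z → c * (2 ^ k + z)) (sym (+-identityʳ _)))

sumOver-const : ∀ {m} (A : Subset m) c → sumOver A (λ _ → c) ≡ c * 2 ^ ∣ A ∣
sumOver-const [] c = sym (*-identityʳ c)
sumOver-const (inside ∷ A) c = trans (cong₂ _+_ (sumOver-const A c) (sumOver-const A c)) (*-2^-double c ∣ A ∣)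
sumOver-const (outside ∷ A) c = sumOver-const A c

sum-allSubsets : ∀ m (f : Subset m → ℕ) → sum (map f (allSubsets m)) ≡ sumOver ⊤ f
sum-allSubsets zero f = +-identityʳ (f [])
sum-allSubsets (suc m) f = begin
  sum (map f (map (inside ∷_) S ++ map (outside ∷_) S))                ≡⟨ cong sum (map-++ f (map (inside ∷_) S) _) ⟩
  sum (map f (map (inside ∷_) S) ++ map f (map (outside ∷_) S))        ≡⟨ sum-++ (map f (map (inside ∷_) S)) _ ⟩
  sum (map f (map (inside ∷_) S)) + sum (map f (map (outside ∷_) S))  ≡⟨ cong₂ _+_ (cong sum (map-∘ S)) (cong sum (map-∘ S)) ⟨
  sum (map (f ∘ (inside ∷_)) S) + sum (map (f ∘ (outside ∷_)) S)      ≡⟨ cong₂ _+_ (sum-allSubsets m _) (sum-allSubsets m _) ⟩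
  sumOver ⊤ f ∎
  where
  open ≡-Reasoning
  S = allSubsets m

∣tabulate∣ : ∀ {m} (f : Fin m → Bool) → ∣ Vec.tabulate f ∣ ≡ sum (tabulate (boolToℕ ∘ f))
∣tabulate∣ {zero} f = refl
∣tabulate∣ {suc m} f with f zero
... | true = cong suc (∣tabulate∣ (f ∘ suc))
... | false = ∣tabulate∣ (f ∘ suc)

-- Finner's inequality

-- A factor (A , g) stands for the function x ↦ g (A ∩ x), which depends only on the coordinates in A.
Factor : ℕ → Set
Factor m = Subset m × (Subset m → ℕ)

eval : ∀ {m} → Subset m → Factor m → ℕ
eval x (A , g) = g (A ∩ x)

sumOfProducts : ∀ {m} → List (Factor m) → ℕ
sumOfProducts fs = sumOver ⊤ (λ x → product (map (eval x) fs))

multiplicity : ∀ {m} → Fin m → List (Factor m) → ℕ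
multiplicity i fs = sum (map (λ f → boolToℕ (lookup (proj₁ f) i)) fs)

module Finner (e : ℕ) .{{_ : NonZero e}} where
  open CeilingRoot e
  open ScaledHolder e

  normᵉ : ∀ {m} → Factor m → ℕ
  normᵉ (A , g) = sumOver A (λ y → g y ^ e)

  productOfNorms : ∀ {m} → List (Factor m) → ℕ
  productOfNorms fs = product (map normᵉ fs)

  -- Summing out the first coordinate replaces a factor containing it by the ceiling of M times its
  -- Lᵉ-norm along that coordinate.
  collapse : ∀ {m} → ℕ → Factor (suc m) → Factor m
  collapse M (inside ∷ A , g) = A , λ y → proj₁ (ceilingRoot (M ^ e * (g (inside ∷ y) ^ e + g (outside ∷ y) ^ e)))
  collapse M (outside ∷ A , g) = A , g ∘ (outside ∷_)

  multiplicity-collapse : ∀ {m} M (fs : List (Factor (suc m))) i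
                        → multiplicity i (map (collapse M) fs) ≡ multiplicity (suc i) fs
  multiplicity-collapse M [] i = refl
  multiplicity-collapse M ((inside ∷ A , g) ∷ fs) i = cong (boolToℕ (lookup A i) +_) (multiplicity-collapse M fs i)
  multiplicity-collapse M ((outside ∷ A , g) ∷ fs) i = cong (boolToℕ (lookup A i) +_) (multiplicity-collapse M fs i)

  column : ∀ {m} M → Subset m → Factor (suc m) → Column M
  column M x (inside ∷ A , g) with ceilingRoot (M ^ e * (g (inside ∷ A ∩ x) ^ e + g (outside ∷ A ∩ x) ^ e))
  ... | H , Mᵉ[uᵉ+vᵉ]≤Hᵉ , _ = active (g (inside ∷ A ∩ x)) (g (outside ∷ A ∩ x)) H Mᵉ[uᵉ+vᵉ]≤Hᵉ
  column M x (outside ∷ A , g) = passive (g (outside ∷ A ∩ x))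

  module _ {m : ℕ} (M : ℕ) (x : Subset m) where

    ends-column : ∀ f → ends M (column M x f) ≡ (eval (inside ∷ x) f , eval (outside ∷ x) f)
    ends-column (inside ∷ A , g) = refl
    ends-column (outside ∷ A , g) = refl

    merged-column : ∀ f → merged M (column M x f) ≡ eval x (collapse M f)
    merged-column (inside ∷ A , g) = refl
    merged-column (outside ∷ A , g) = refl

    activeCount-columns : ∀ fs → activeCount M (map (column M x) fs) ≡ multiplicity zero fs
    activeCount-columns [] = refl
    activeCount-columns ((inside ∷ A , g) ∷ fs) = cong suc (activeCount-columns fs)
    activeCount-columns ((outside ∷ A , g) ∷ fs) = activeCount-columns fs

    product-columns : ∀ (f : Column M → ℕ) {h} → (∀ φ → f (column M x φ) ≡ h φ) → ∀ fs
                    → product (map f (map (column M x) fs)) ≡ product (map h fs)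
    product-columns f f∘column≗h fs = cong product (trans (sym (map-∘ fs)) (map-cong f∘column≗h fs))

    fibreBound : ∀ fs → multiplicity zero fs ≡ e
               → M ^ e * (product (map (eval (inside ∷ x)) fs) + product (map (eval (outside ∷ x)) fs))
                 ≤ product (map (eval x) (map (collapse M) fs))
    fibreBound fs mult≡e = begin
      M ^ e * (product (map (eval (inside ∷ x)) fs) + product (map (eval (outside ∷ x)) fs))
        ≡⟨ cong₂ (λ a b → M ^ e * (a + b)) (product-columns (proj₁ ∘ ends M) (cong proj₁ ∘ ends-column) fs)
                                            (product-columns (proj₂ ∘ ends M) (cong proj₂ ∘ ends-column) fs) ⟨
      M ^ e * (product (map (proj₁ ∘ ends M) cs) + product (map (proj₂ ∘ ends M) cs))
        ≤⟨ scaledHolder M cs (trans (activeCount-columns fs) mult≡e) ⟩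
      product (map (merged M) cs)
        ≡⟨ product-columns (merged M) merged-column fs ⟩
      product (map (eval x ∘ collapse M) fs)
        ≡⟨ cong product (map-∘ fs) ⟩
      product (map (eval x) (map (collapse M) fs)) ∎
      where
      open ≤-Reasoning
      cs = map (column M x) fs

  sumOfProducts-collapse : ∀ {m} M (fs : List (Factor (suc m))) → multiplicity zero fs ≡ e
                         → M ^ e * sumOfProducts fs ≤ sumOfProducts (map (collapse M) fs)
  sumOfProducts-collapse {m} M fs mult≡e = begin
    M ^ e * (sumOver ⊤ (P ∘ (inside ∷_)) + sumOver ⊤ (P ∘ (outside ∷_))) ≡⟨ cong (M ^ e *_) (sumOver-+ (⊤ {m}) (P ∘ (inside ∷_)) (P ∘ (outside ∷_))) ⟨
    M ^ e * sumOver ⊤ (λ x → P (inside ∷ x) + P (outside ∷ x))         ≡⟨ sumOver-*ˡ (⊤ {m}) (M ^ e) _ ⟨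
    sumOver ⊤ (λ x → M ^ e * (P (inside ∷ x) + P (outside ∷ x)))       ≤⟨ sumOver-mono-≤ (⊤ {m}) (λ x → fibreBound M x fs mult≡e) ⟩
    sumOfProducts (map (collapse M) fs)                                 ∎
    where
    open ≤-Reasoning
    P : Subset (suc m) → ℕ
    P x = product (map (eval x) fs)

  normᵉ-collapse : ∀ {m} M (f : Factor (suc m))
                 → normᵉ (collapse M f) ≤ (suc M ^ e) ^ boolToℕ (lookup (proj₁ f) zero) * normᵉ f
  normᵉ-collapse M (inside ∷ A , g) = begin
    sumOver A (λ y → proj₁ (root y) ^ e)       ≤⟨ sumOver-mono-≤ A (λ y → ceilingRoot-scaled M (Φ y) (proj₁ (root y)) (proj₂ (root y))) ⟩
    sumOver A (λ y → suc M ^ e * Φ y)          ≡⟨ sumOver-*ˡ A (suc M ^ e) Φ ⟩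
    suc M ^ e * sumOver A Φ                    ≡⟨ cong (suc M ^ e *_) (sumOver-+ A _ _) ⟩
    suc M ^ e * normᵉ (inside ∷ A , g)         ≡⟨ cong (_* normᵉ (inside ∷ A , g)) (*-identityʳ (suc M ^ e)) ⟨
    (suc M ^ e) ^ 1 * normᵉ (inside ∷ A , g)     ∎
    where
    open ≤-Reasoning
    Φ = λ y → g (inside ∷ y) ^ e + g (outside ∷ y) ^ e
    root = λ y → ceilingRoot (M ^ e * Φ y)
  normᵉ-collapse M (outside ∷ A , g) = ≤-reflexive (sym (+-identityʳ _))

  productOfNorms-collapse : ∀ {m} M (fs : List (Factor (suc m)))
                          → productOfNorms (map (collapse M) fs) ≤ (suc M ^ e) ^ multiplicity zero fs * productOfNorms fs
  productOfNorms-collapse M [] = ≤-refl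
  productOfNorms-collapse M (f ∷ fs) = begin
    normᵉ (collapse M f) * productOfNorms (map (collapse M) fs)
      ≤⟨ *-mono-≤ (normᵉ-collapse M f) (productOfNorms-collapse M fs) ⟩
    c ^ k * normᵉ f * (c ^ multiplicity zero fs * productOfNorms fs)
      ≡⟨ *-interchange (c ^ k) (normᵉ f) _ _ ⟩
    c ^ k * c ^ multiplicity zero fs * (normᵉ f * productOfNorms fs)
      ≡⟨ cong (_* (normᵉ f * productOfNorms fs)) (^-distribˡ-+-* c k _) ⟨
    c ^ multiplicity zero (f ∷ fs) * productOfNorms (f ∷ fs) ∎
    where
    open ≤-Reasoning
    c = suc M ^ e
    k = boolToℕ (lookup (proj₁ f) zero)

  sumOfProducts-base : (fs : List (Factor 0)) → sumOfProducts fs ^ e ≡ productOfNorms fs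
  sumOfProducts-base fs = trans (product-map-^ (eval []) e fs) (cong product (map-cong evalᵉ≡normᵉ fs))
    where
    evalᵉ≡normᵉ : ∀ (f : Factor 0) → eval [] f ^ e ≡ normᵉ f
    evalᵉ≡normᵉ ([] , g) = refl

  -- Each of the m collapses costs a factor ((M + 1) / M) ^ (e e).
  finner-scaled : ∀ m (fs : List (Factor m)) → (∀ i → multiplicity i fs ≡ e) → ∀ M
                → sumOfProducts fs ^ e * (M ^ (e * e)) ^ m ≤ (suc M ^ (e * e)) ^ m * productOfNorms fs
  finner-scaled zero fs _ M =
    ≤-reflexive (trans (*-identityʳ _) (trans (sumOfProducts-base fs) (sym (*-identityˡ _))))
  finner-scaled (suc m) fs mult≡e M = begin
    S ^ e * (M ^ (e * e) * X)                      ≡⟨ *-assoc (S ^ e) _ X ⟨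
    S ^ e * M ^ (e * e) * X                        ≡⟨ cong (_* X) scale ⟩
    (M ^ e * S) ^ e * X                            ≤⟨ *-monoˡ-≤ X (^-monoˡ-≤ e (sumOfProducts-collapse M fs (mult≡e zero))) ⟩
    sumOfProducts fs′ ^ e * X                      ≤⟨ finner-scaled m fs′ mult′≡e M ⟩
    Y * productOfNorms fs′                         ≤⟨ *-monoʳ-≤ Y (productOfNorms-collapse M fs) ⟩
    Y * ((suc M ^ e) ^ multiplicity zero fs * N)   ≡⟨ cong (λ k → Y * ((suc M ^ e) ^ k * N)) (mult≡e zero) ⟩
    Y * ((suc M ^ e) ^ e * N)                      ≡⟨ cong (λ z → Y * (z * N)) (^-*-assoc (suc M) e e) ⟩
    Y * (suc M ^ (e * e) * N)                      ≡⟨ x*[y*z]≡[y*x]*z Y (suc M ^ (e * e)) N ⟩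
    suc M ^ (e * e) * Y * N                        ∎
    where
    open ≤-Reasoning
    S = sumOfProducts fs
    N = productOfNorms fs
    X = (M ^ (e * e)) ^ m
    Y = (suc M ^ (e * e)) ^ m
    fs′ = map (collapse M) fs
    mult′≡e : ∀ i → multiplicity i fs′ ≡ e
    mult′≡e i = trans (multiplicity-collapse M fs i) (mult≡e (suc i))
    scale : S ^ e * M ^ (e * e) ≡ (M ^ e * S) ^ e
    scale = begin-equality
      S ^ e * M ^ (e * e)    ≡⟨ *-comm (S ^ e) _ ⟩
      M ^ (e * e) * S ^ e    ≡⟨ cong (_* S ^ e) (^-*-assoc M e e) ⟨
      (M ^ e) ^ e * S ^ e    ≡⟨ ^-distribʳ-* (M ^ e) S e ⟨
      (M ^ e * S) ^ e        ∎

  finner : ∀ m (fs : List (Factor m)) → (∀ i → multiplicity i fs ≡ e) → sumOfProducts fs ^ e ≤ productOfNorms fs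
  finner m fs mult≡e = ≤-by-scaling (sumOfProducts fs ^ e) (productOfNorms fs) (e * e * m) λ M →
    subst₂ (λ a b → sumOfProducts fs ^ e * a ≤ b) (^-*-assoc M (e * e) m)
           (trans (*-comm _ (productOfNorms fs)) (cong (productOfNorms fs *_) (^-*-assoc (suc M) (e * e) m)))
           (finner-scaled m fs mult≡e M)

-- Independent sets

isEmpty : ∀ {m} → Subset m → Bool
isEmpty [] = true
isEmpty (b ∷ y) = not b ∧ isEmpty y

isEmpty-∩ : ∀ {m} (A S : Subset m) → isEmpty (A ∩ S) ≡ and (tabulate (λ l → not (lookup S l ∧ lookup A l)))
isEmpty-∩ [] [] = refl
isEmpty-∩ (a ∷ A) (s ∷ S) = cong₂ (λ x y → not x ∧ y) (∧-comm a s) (isEmpty-∩ A S)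

-- Every subset of A but the empty one contributes h false.
sumOver-isEmpty : ∀ {m} (A : Subset m) (h : Bool → ℕ) → sumOver A (h ∘ isEmpty) + h false ≡ h true + h false * 2 ^ ∣ A ∣
sumOver-isEmpty [] h = cong (h true +_) (sym (*-identityʳ (h false)))
sumOver-isEmpty (inside ∷ A) h = begin
  sumOver A (λ _ → h false) + sumOver A (h ∘ isEmpty) + h false  ≡⟨ +-assoc (sumOver A (λ _ → h false)) _ _ ⟩
  sumOver A (λ _ → h false) + (sumOver A (h ∘ isEmpty) + h false) ≡⟨ cong₂ _+_ (sumOver-const A (h false)) (sumOver-isEmpty A h) ⟩
  x + (h true + x)                                                ≡⟨ x+[y+z]≡y+[x+z] x (h true) x ⟩
  h true + (x + x)                                                ≡⟨ cong (h true +_) (*-2^-double (h false) ∣ A ∣) ⟩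
  h true + h false * 2 ^ suc ∣ A ∣                                 ∎
  where
  open ≡-Reasoning
  x = h false * 2 ^ ∣ A ∣
sumOver-isEmpty (outside ∷ A) h = sumOver-isEmpty A h

-- Counts the T avoiding every r with ¬ c r: each r with c r may or may not lie in T.
sumOver-admissible : ∀ {n} (c : Fin n → Bool)
                   → sumOver ⊤ (λ T → boolToℕ (and (tabulate (λ r → not (lookup T r) ∨ c r))))
                     ≡ product (tabulate (λ r → if c r then 2 else 1))
sumOver-admissible {zero} c = refl
sumOver-admissible {suc n} c with c zero
... | true = trans (cong₂ _+_ rest rest) (cong (P +_) (sym (+-identityʳ P)))
  where
  P = product (tabulate (λ r → if c (suc r) then 2 else 1))
  rest = sumOver-admissible (c ∘ suc)
... | false = trans (cong (_+ sumOver ⊤ admissible) (sumOver-const (⊤ {n}) 0))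
                    (trans (sumOver-admissible (c ∘ suc)) (sym (+-identityʳ _)))
  where
  admissible : Subset n → ℕ
  admissible T = boolToℕ (and (tabulate (λ r → not (lookup T r) ∨ c (suc r))))

module NeighbourhoodFactors {m n : ℕ} (G : BipGraph m n) where

  neighbourhood : Fin n → Subset m
  neighbourhood r = Vec.tabulate (λ l → G l r)

  -- Given S ⊆ L, the vertex r can be in T or not if S misses its neighbourhood, and must be out otherwise.
  choices : Subset m → ℕ
  choices y = if isEmpty y then 2 else 1

  factors : List (Factor m)
  factors = tabulate (λ r → neighbourhood r , choices)

  isIndependent≡admissible : ∀ S T → isIndependent G (S , T)
                           ≡ and (tabulate (λ r → not (lookup T r) ∨ isEmpty (neighbourhood r ∩ S)))
  isIndependent≡admissible S T = begin
    isIndependent G (S , T)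
      ≡⟨ cong and (trans (map-allFin {m} _) (tabulate-cong (λ l → cong and (map-allFin {n} _)))) ⟩
    and (tabulate (λ l → and (tabulate (λ r → not (lookup S l ∧ lookup T r ∧ G l r)))))
      ≡⟨ and-tabulate-comm {m} {n} _ ⟩
    and (tabulate (λ r → and (tabulate (λ l → not (lookup S l ∧ lookup T r ∧ G l r)))))
      ≡⟨ cong and (tabulate-cong {n = n} (λ r → and-tabulate-guard (lookup T r) (lookup S) (λ l → G l r))) ⟩
    and (tabulate (λ r → not (lookup T r) ∨ and (tabulate (λ l → not (lookup S l ∧ G l r)))))
      ≡⟨ cong and (tabulate-cong {n = n} (λ r → cong (not (lookup T r) ∨_) (sym (isEmpty-neighbourhood r)))) ⟩
    and (tabulate (λ r → not (lookup T r) ∨ isEmpty (neighbourhood r ∩ S))) ∎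
    where
    open ≡-Reasoning
    isEmpty-neighbourhood : ∀ r → isEmpty (neighbourhood r ∩ S) ≡ and (tabulate (λ l → not (lookup S l ∧ G l r)))
    isEmpty-neighbourhood r = trans (isEmpty-∩ (neighbourhood r) S)
      (cong and (tabulate-cong {n = m} (λ l → cong (λ b → not (lookup S l ∧ b)) (lookup∘tabulate (λ l → G l r) l))))

  numIndependentSets≡sumOfProducts : numIndependentSets G ≡ sumOfProducts factors
  numIndependentSets≡sumOfProducts = begin
    numIndependentSets G
      ≡⟨ length-filter-T? (isIndependent G) (cartesianProduct (allSubsets m) (allSubsets n)) ⟩
    sum (map (boolToℕ ∘ isIndependent G) (cartesianProduct (allSubsets m) (allSubsets n)))
      ≡⟨ sum-cartesianProduct (boolToℕ ∘ isIndependent G) (allSubsets m) (allSubsets n) ⟩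
    sum (map (λ S → sum (map (λ T → boolToℕ (isIndependent G (S , T))) (allSubsets n))) (allSubsets m))
      ≡⟨ sum-allSubsets m _ ⟩
    sumOver ⊤ (λ S → sum (map (λ T → boolToℕ (isIndependent G (S , T))) (allSubsets n)))
      ≡⟨ sumOver-cong (⊤ {m}) independentExtensions ⟩
    sumOfProducts factors ∎
    where
    open ≡-Reasoning
    independentExtensions : ∀ S → sum (map (λ T → boolToℕ (isIndependent G (S , T))) (allSubsets n))
                                  ≡ product (map (eval S) factors)
    independentExtensions S = begin
      sum (map (λ T → boolToℕ (isIndependent G (S , T))) (allSubsets n))
        ≡⟨ sum-allSubsets n _ ⟩
      sumOver ⊤ (λ T → boolToℕ (isIndependent G (S , T)))
        ≡⟨ sumOver-cong (⊤ {n}) (cong boolToℕ ∘ isIndependent≡admissible S) ⟩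
      sumOver ⊤ (λ T → boolToℕ (and (tabulate (λ r → not (lookup T r) ∨ isEmpty (neighbourhood r ∩ S)))))
        ≡⟨ sumOver-admissible (λ r → isEmpty (neighbourhood r ∩ S)) ⟩
      product (tabulate (λ r → choices (neighbourhood r ∩ S)))
        ≡⟨ cong product (map-tabulate {n = n} _ (eval S)) ⟨
      product (map (eval S) factors) ∎

  multiplicity-factors : ∀ l → multiplicity l factors ≡ degL G l
  multiplicity-factors l = begin
    sum (map (λ f → boolToℕ (lookup (proj₁ f) l)) factors)  ≡⟨ cong sum (map-tabulate {n = n} _ _) ⟩
    sum (tabulate (λ r → boolToℕ (lookup (neighbourhood r) l))) ≡⟨ cong sum (tabulate-cong {n = n} (λ r → cong boolToℕ (lookup∘tabulate (λ l → G l r) l))) ⟩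
    sum (tabulate (λ r → boolToℕ (G l r)))                  ≡⟨ cong sum (map-allFin {n} _) ⟨
    degL G l                                                ∎
    where open ≡-Reasoning

  normᵉ-factor : ∀ e .{{_ : NonZero e}} r → Finner.normᵉ e (neighbourhood r , choices) ≡ weight G e (degR G r)
  normᵉ-factor e r = begin
    total                            ≡⟨ m+n∸n≡m total 1 ⟨
    total + 1 ∸ 1                    ≡⟨ cong (λ z → total + z ∸ 1) (^-zeroˡ e) ⟨
    total + h false ∸ 1              ≡⟨ cong (_∸ 1) (sumOver-isEmpty (neighbourhood r) h) ⟩
    2 ^ e + h false * 2 ^ ∣ N ∣ ∸ 1  ≡⟨ cong (λ z → 2 ^ e + z * 2 ^ ∣ N ∣ ∸ 1) (^-zeroˡ e) ⟩
    2 ^ e + 1 * 2 ^ ∣ N ∣ ∸ 1        ≡⟨ cong (λ z → 2 ^ e + z ∸ 1) (*-identityˡ _) ⟩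
    2 ^ e + 2 ^ ∣ N ∣ ∸ 1            ≡⟨ cong (λ k → 2 ^ e + 2 ^ k ∸ 1) (trans (∣tabulate∣ (λ l → G l r)) (cong sum (sym (map-allFin {m} _)))) ⟩
    weight G e (degR G r)            ∎
    where
    open ≡-Reasoning
    N = neighbourhood r
    h : Bool → ℕ
    h b = (if b then 2 else 1) ^ e
    total = sumOver N (h ∘ isEmpty)

  productOfNorms-factors : ∀ e .{{_ : NonZero e}} → Finner.productOfNorms e factors ≡ rightProduct G e
  productOfNorms-factors e = begin
    product (map (Finner.normᵉ e) factors)                         ≡⟨ cong product (map-tabulate {n = n} _ _) ⟩
    product (tabulate (λ r → Finner.normᵉ e (neighbourhood r , choices))) ≡⟨ cong product (tabulate-cong (normᵉ-factor e)) ⟩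
    product (tabulate (λ r → weight G e (degR G r)))               ≡⟨ cong product (map-allFin {n} _) ⟨
    rightProduct G e                                                ∎
    where open ≡-Reasoning

independentSets-^-≤-rightProduct : ∀ {m n} (G : BipGraph m n) d → (∀ l → degL G l ≡ d)
                                 → numIndependentSets G ^ d ≤ rightProduct G d
independentSets-^-≤-rightProduct {n = n} G zero _ =
  >-nonZero⁻¹ (rightProduct G 0) {{product≢0 (All.map⁺ (All.universal (weight≢0 ∘ degR G) (allFin n)))}}
  where
  weight≢0 : ∀ k → NonZero (weight G 0 k)
  weight≢0 k = >-nonZero (subst (0 <_) (sym (m+n∸m≡n 1 (2 ^ k))) (m^n>0 2 k))
independentSets-^-≤-rightProduct {m} G d@(suc _) deg≡d = subst₂ (λ a b → a ^ d ≤ b)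
  (sym numIndependentSets≡sumOfProducts) (productOfNorms-factors d)
  (Finner.finner d m factors (λ l → trans (multiplicity-factors l) (deg≡d l)))
  where open NeighbourhoodFactors G

-- Around a right vertex r all edge weights equal weight G d (degR G r), and their exponents sum to a.
rightProduct-^-edgeProduct : ∀ {m n} (G : BipGraph m n) d (K a : ℕ) (e : Fin m → Fin n → ℕ)
  → (∀ l → 1 ≤ degL G l) → (∀ r → 1 ≤ degR G r) → (∀ l → degL G l ≡ d) → a * d ≡ K
  → (∀ l r → G l r ≡ true → e l r * (degL G l * degR G r) ≡ K)
  → rightProduct G d ^ a ≡ edgeProduct G e
rightProduct-^-edgeProduct {m} {n} G d K a e degL≥1 degR≥1 degL≡d ad≡K edge≡K = begin
  product (map w (allFin n)) ^ a                                         ≡⟨ product-map-^ w a (allFin n) ⟩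
  product (map (λ r → w r ^ a) (allFin n))                                ≡⟨ cong product (map-cong (sym ∘ column) (allFin n)) ⟩
  product (map (λ r → product (map (λ l → F l r) (allFin m))) (allFin n)) ≡⟨ product-swap F (allFin m) (allFin n) ⟨
  edgeProduct G e                                                          ∎
  where
  open ≡-Reasoning
  w : Fin n → ℕ
  w r = weight G d (degR G r)
  F : Fin m → Fin n → ℕ
  F l r = if G l r then weight G (degL G l) (degR G r) ^ e l r else 1

  edgeExponent : ∀ l r → G l r ≡ true → e l r * degR G r ≡ a
  edgeExponent l r lr = *-cancelʳ-≡ _ a d {{>-nonZero (subst (1 ≤_) (degL≡d l) (degL≥1 l))}} (begin
    e l r * degR G r * d            ≡⟨ *-assoc (e l r) _ d ⟩
    e l r * (degR G r * d)          ≡⟨ x*[y*z]≡x*[z*y] (e l r) (degR G r) d ⟩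
    e l r * (d * degR G r)          ≡⟨ cong (λ z → e l r * (z * degR G r)) (degL≡d l) ⟨
    e l r * (degL G l * degR G r)   ≡⟨ edge≡K l r lr ⟩
    K                               ≡⟨ ad≡K ⟨
    a * d                           ∎)

  exponentSum : ∀ r → sum (map (λ l → if G l r then e l r else 0) (allFin m)) ≡ a
  exponentSum r = *-cancelʳ-≡ _ a (degR G r) {{>-nonZero (degR≥1 r)}}
    (sum-map-if-* (λ l → G l r) (λ l → e l r) a (degR G r) (allFin m) (λ l → edgeExponent l r))

  column : ∀ r → product (map (λ l → F l r) (allFin m)) ≡ w r ^ a
  column r = begin
    product (map (λ l → F l r) (allFin m))
      ≡⟨ cong product (map-cong (λ l → cong (λ z → if G l r then weight G z (degR G r) ^ e l r else 1) (degL≡d l)) (allFin m)) ⟩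
    product (map (λ l → if G l r then w r ^ e l r else 1) (allFin m))
      ≡⟨ product-map-if-^ (λ l → G l r) (w r) (λ l → e l r) (allFin m) ⟩
    w r ^ sum (map (λ l → if G l r then e l r else 0) (allFin m))
      ≡⟨ cong (w r ^_) (exponentSum r) ⟩
    w r ^ a ∎

mainTheorem2 : (m n : ℕ) (G : BipGraph m n) (d : ℕ)
    → (∀ l → 1 ≤ degL G l)
    → (∀ r → 1 ≤ degR G r)
    → (∀ l → degL G l ≡ d)
    → (numIndependentSets G ^ d ≤ rightProduct G d)
      × (∀ (K a : ℕ) (e : Fin m → Fin n → ℕ) → 0 < K → a * d ≡ K
          → (∀ l r → G l r ≡ true → e l r * (degL G l * degR G r) ≡ K)
          → rightProduct G d ^ a ≡ edgeProduct G e)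
mainTheorem2 m n G d degL≥1 degR≥1 degL≡d =
  independentSets-^-≤-rightProduct G d degL≡d ,
  λ K a e _ ad≡K edge≡K → rightProduct-^-edgeProduct G d K a e degL≥1 degR≥1 degL≡d ad≡K edge≡K
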